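{- Let $\mathsf M$ be a matroid and $\eta$ an orientation of $\mathsf M$. (1) If $\mathsf M$ has parallel elements then $[\mathsf M,\eta]=0$. (2) If $\mathsf M$ has two or more loops then $[\mathsf M,\eta]=0$. (3) If $\mathsf M$ has elements in series then $[\mathsf M,\eta]=0$. (4) If $\mathsf M$ has two or more coloops then $[\mathsf M,\eta]=0$.
   Context: Two elements $x,y$ of a matroid are parallel if $\{x,y\}$ is a circuit; they are in series if every basis contains $x$ or $y$ and $\{x,y\}$ is minimal with this property. An orientation of $\mathsf M$ is a generator $\eta$ of $\bigwedge^{|E|}\mathbb{Z}\langle E\rangle$, $E=E(\mathsf M)$. $\mathcal M$ is the $\mathbb{Q}$-vector space spanned by symbols $[\mathsf M,\eta]$ modulo $[\mathsf M,-\eta]=-[\mathsf M,\eta]$ and $[\mathsf M,\eta]=[\mathsf M',\psi_*\eta]$ for every matroid isomorphism $\psi:\mathsf M\to\mathsf M'$ ($\psi_*$ the induced map on top exterior powers). -}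

module Defs where

open import Data.Nat using (ℕ; zero; suc; _+_)
open import Data.Bool using (Bool; true; false; if_then_else_)
open import Data.Fin using (Fin; _<?_)
open import Data.Fin.Subset using (Subset; _∈_; _∉_; _⊆_; _⊂_; _∪_; _-_; ⁅_⁆)
open import Data.Fin.Permutation using (Permutation′; _⟨$⟩ʳ_; _⟨$⟩ˡ_)
open import Data.Vec using (tabulate; lookup)
open import Data.List using (List; map; allFin)
open import Data.Nat.ListAction using (sum)
open import Data.Sign using (Sign; opposite) renaming (_*_ to _*ₛ_)
open import Data.Rational using (ℚ; 0ℚ; -_)
open import Data.Product using (Σ; ∃; ∃-syntax; _×_; _,_)
open import Data.Sum using (_⊎_)
open import Relation.Nullary using (¬_; does)
open import Relation.Binary.PropositionalEquality using (_≡_; _≢_)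

record Matroid (n : ℕ) : Set where
  field
    isBasis  : Subset n → Bool
    nonempty : ∃[ B ] isBasis B ≡ true
    exchange : ∀ B₁ B₂ → isBasis B₁ ≡ true → isBasis B₂ ≡ true →
               ∀ x → x ∈ B₁ → x ∉ B₂ →
               ∃[ y ] (y ∈ B₂ × y ∉ B₁ × isBasis ((B₁ - x) ∪ ⁅ y ⁆) ≡ true)

module _ {n : ℕ} (M : Matroid n) where
  open Matroid M

  IsBasis : Subset n → Set
  IsBasis B = isBasis B ≡ true

  Independent : Subset n → Set
  Independent S = ∃[ B ] (IsBasis B × S ⊆ B)

  Dependent : Subset n → Set
  Dependent S = ¬ Independent S

  Circuit : Subset n → Set
  Circuit C = Dependent C × (∀ D → D ⊂ C → Independent D)

  Parallel : Fin n → Fin n → Set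
  Parallel x y = x ≢ y × Circuit (⁅ x ⁆ ∪ ⁅ y ⁆)

  Loop : Fin n → Set
  Loop x = Circuit ⁅ x ⁆

  Coloop : Fin n → Set
  Coloop x = ∀ B → IsBasis B → x ∈ B

  MeetsAllBases : Subset n → Set
  MeetsAllBases S = ∀ B → IsBasis B → ∃[ z ] (z ∈ S × z ∈ B)

  Series : Fin n → Fin n → Set
  Series x y = x ≢ y × MeetsAllBases (⁅ x ⁆ ∪ ⁅ y ⁆)
               × (∀ S → S ⊂ (⁅ x ⁆ ∪ ⁅ y ⁆) → ¬ MeetsAllBases S)

  HasParallel : Set
  HasParallel = ∃[ x ] ∃[ y ] Parallel x y

  HasTwoLoops : Set
  HasTwoLoops = ∃[ x ] ∃[ y ] (x ≢ y × Loop x × Loop y)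

  HasSeries : Set
  HasSeries = ∃[ x ] ∃[ y ] Series x y

  HasTwoColoops : Set
  HasTwoColoops = ∃[ x ] ∃[ y ] (x ≢ y × Coloop x × Coloop y)

-- Orientations.  For E = Fin n, ⋀^n ℤ⟨E⟩ ≅ ℤ with basis e₀ ∧ … ∧ e_{n-1};
-- its generators are ± that element, encoded by a Sign.

Orientation : ℕ → Set
Orientation _ = Sign

inversions : {n : ℕ} → (Fin n → Fin n) → ℕ
inversions {n} f =
  sum (map (λ i → sum (map (λ j →
        if does (i <? j) then (if does (f j <? f i) then 1 else 0) else 0)
      (allFin n))) (allFin n))

parity : ℕ → Sign
parity zero    = Sign.+
parity (suc k) = opposite (parity k)

sgn : {n : ℕ} → Permutation′ n → Sign
sgn ψ = parity (inversions (ψ ⟨$⟩ʳ_))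

-- induced map on the top exterior power:
-- e₀ ∧ … ∧ e_{n-1} ↦ e_{ψ 0} ∧ … ∧ e_{ψ (n-1)} = sgn ψ · e₀ ∧ … ∧ e_{n-1}
push : {n : ℕ} → Permutation′ n → Orientation n → Orientation n
push ψ η = sgn ψ *ₛ η

image : {n : ℕ} → Permutation′ n → Subset n → Subset n
image ψ B = tabulate (λ i → lookup B (ψ ⟨$⟩ˡ i))

IsIso : {n : ℕ} → Matroid n → Matroid n → Permutation′ n → Set
IsIso M M' ψ = ∀ B → Matroid.isBasis M' (image ψ B) ≡ Matroid.isBasis M B

-- The space 𝓜.  A ℚ-linear functional on 𝓜 is the same as a ℚ-valued
-- function on the symbols [M, η] respecting the defining relations.

RespectsRelations : ((n : ℕ) → Matroid n → Orientation n → ℚ) → Set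
RespectsRelations f =
  (∀ n (M : Matroid n) η → f n M (opposite η) ≡ - f n M η)
  × (∀ n (M M' : Matroid n) ψ → IsIso M M' ψ → ∀ η → f n M η ≡ f n M' (push ψ η))

-- [M, η] = 0 in 𝓜: every linear functional on 𝓜 vanishes on it
IsZeroIn𝓜 : {n : ℕ} → Matroid n → Orientation n → Set
IsZeroIn𝓜 {n} M η =
  ∀ (f : (m : ℕ) → Matroid m → Orientation m → ℚ) → RespectsRelations f → f n M η ≡ 0ℚ

{-# OPTIONS --safe #-}
module Submission where

-- In each of the four cases the transposition τ of the two distinguished elements x, y is an
-- automorphism of M. For that it suffices that B - x + y is a basis whenever the basis B contains
-- x but not y, and symmetrically. For loops and coloops this holds vacuously; for elements in
-- series it is a single basis exchange against a basis avoiding x; for parallel elements a basis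
-- through y is pushed into B ∪ {y} by exchanges, and then has to be B - x + y, because it cannot
-- contain x and any other element of B it misses could only be exchanged for y.
-- An automorphism ψ gives [M, η] = [M, sgn ψ · η], so an odd one forces [M, η] = -[M, η] = 0.
-- As the sign is defined by counting inversions, it is computed only for the transposition (0 1),
-- to which τ is conjugated by relabelling the ground set.

open import Defs
open import Data.Nat using (ℕ; zero; suc; _+_; _<_; 2+)
open import Data.Nat.Induction using (<-wellFounded)
open import Induction.WellFounded using (Acc; acc)
open import Data.Bool using (true; if_then_else_)
open import Data.Bool.Properties using (⇔→≡) renaming (_≟_ to _≟ᵇ_)
open import Data.Empty using (⊥-elim)
open import Data.Fin using (Fin; zero; suc; _<?_)
open import Data.Fin.Patterns using (0F; 1F)
open import Data.Fin.Properties using (_≟_) renaming (<-asym to <-asymᶠ)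
open import Data.Fin.Subset using (Subset; _∈_; _∉_; _⊆_; _⊂_; _∪_; _─_; _-_; ⁅_⁆; ∣_∣; inside; outside)
open import Data.Fin.Subset.Properties
  using (_∈?_; x∈⁅x⁆; x∈⁅y⁆⇒x≡y; x∉⁅y⁆⇒x≢y; x∈p∪q⁻; x∈p∪q⁺; p─q⊆p; x∈p∧x≢y⇒x∈p-y;
         x∈p∧x∉q⇒x∈p─q; ⊆-antisym; ∪-comm; p⊂q⇒∣p∣<∣q∣; nonempty?; anySubset?)
open import Data.Fin.Permutation
  using (Permutation′; _⟨$⟩ʳ_; _⟨$⟩ˡ_; inverseˡ; inverseʳ; flip; transpose; _∘ₚ_)
import Data.Fin.Permutation.Components as PC
open import Data.Vec using (_∷_; here; there; tabulate; lookup)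
open import Data.Vec.Properties
  using ([]=⇒lookup; lookup⇒[]=; lookup∘tabulate; tabulate-cong; tabulate∘lookup)
open import Data.List as List using (List; map; allFin)
open import Data.List.Relation.Unary.All using (All; []; _∷_)
open import Data.List.Relation.Unary.All.Properties using (tabulate⁺)
open import Data.Nat.ListAction using (sum)
open import Data.Sign using (Sign; opposite) renaming (_*_ to _*ₛ_)
open import Data.Sign.Properties using (s*s≡+; *-assoc)
open import Data.Rational using (ℚ; 0ℚ; -_) renaming (_<_ to _<ℚ_)
open import Data.Rational.Properties using (<-cmp; neg-antimono-<) renaming (<-asym to <-asymℚ)
open import Data.Product using (∃-syntax; _×_; _,_; proj₁)
open import Data.Sum using (_⊎_; inj₁; inj₂)
open import Function using (_∘_; const)
open import Function.Bundles using (mk⇔)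
open import Relation.Binary using (tri<; tri≈; tri>)
open import Relation.Nullary using (¬_; Dec; does; yes; no; ¬?)
open import Relation.Nullary.Decidable using (dec-true; dec-false; decidable-stable; _×-dec_)
open import Relation.Binary.PropositionalEquality

variable
  n : ℕ

x∈p─q⇒x∉q : ∀ {x : Fin n} {p q} → x ∈ p ─ q → x ∉ q
x∈p─q⇒x∉q {p = inside ∷ _} {q = outside ∷ _} here          ()
x∈p─q⇒x∉q {p = _ ∷ _}      {q = _ ∷ _}       (there x∈p─q) (there x∈q) = x∈p─q⇒x∉q x∈p─q x∈q

replace : Subset n → Fin n → Fin n → Subset n
replace p x y = (p - x) ∪ ⁅ y ⁆

module _ {p : Subset n} {i x y : Fin n} where

  ∈-replace⁻ : i ∈ replace p x y → (i ∈ p × i ≢ x) ⊎ i ≡ y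
  ∈-replace⁻ i∈ with x∈p∪q⁻ (p - x) ⁅ y ⁆ i∈
  ... | inj₁ i∈p-x = inj₁ (p─q⊆p p ⁅ x ⁆ i∈p-x , x∉⁅y⁆⇒x≢y (x∈p─q⇒x∉q i∈p-x))
  ... | inj₂ i∈⁅y⁆ = inj₂ (x∈⁅y⁆⇒x≡y y i∈⁅y⁆)

  ∈-replace⁺ˡ : i ∈ p → i ≢ x → i ∈ replace p x y
  ∈-replace⁺ˡ i∈p i≢x = x∈p∪q⁺ (inj₁ (x∈p∧x≢y⇒x∈p-y i∈p i≢x))

  ∈-replace⁺ʳ : i ≡ y → i ∈ replace p x y
  ∈-replace⁺ʳ refl = x∈p∪q⁺ (inj₂ (x∈⁅x⁆ i))

x∈p⇒⁅x⁆⊆p : ∀ {x : Fin n} {p} → x ∈ p → ⁅ x ⁆ ⊆ p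
x∈p⇒⁅x⁆⊆p {x = x} x∈p i∈ rewrite x∈⁅y⁆⇒x≡y x i∈ = x∈p

module _ {x y : Fin n} where

  ∈-pair⁻ : ∀ {i} → i ∈ ⁅ x ⁆ ∪ ⁅ y ⁆ → i ≡ x ⊎ i ≡ y
  ∈-pair⁻ i∈ with x∈p∪q⁻ ⁅ x ⁆ ⁅ y ⁆ i∈
  ... | inj₁ i∈⁅x⁆ = inj₁ (x∈⁅y⁆⇒x≡y x i∈⁅x⁆)
  ... | inj₂ i∈⁅y⁆ = inj₂ (x∈⁅y⁆⇒x≡y y i∈⁅y⁆)

  pair⊆ : ∀ {p} → x ∈ p → y ∈ p → ⁅ x ⁆ ∪ ⁅ y ⁆ ⊆ p
  pair⊆ x∈p y∈p i∈ with ∈-pair⁻ i∈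
  ... | inj₁ refl = x∈p
  ... | inj₂ refl = y∈p

  ⁅x⁆⊂⁅x⁆∪⁅y⁆ : x ≢ y → ⁅ x ⁆ ⊂ ⁅ x ⁆ ∪ ⁅ y ⁆
  ⁅x⁆⊂⁅x⁆∪⁅y⁆ x≢y =
    (λ i∈ → x∈p∪q⁺ (inj₁ i∈)) , y , x∈p∪q⁺ (inj₂ (x∈⁅x⁆ y)) , x≢y ∘ sym ∘ x∈⁅y⁆⇒x≡y x

  ⁅y⁆⊂⁅x⁆∪⁅y⁆ : x ≢ y → ⁅ y ⁆ ⊂ ⁅ x ⁆ ∪ ⁅ y ⁆
  ⁅y⁆⊂⁅x⁆∪⁅y⁆ x≢y =
    (λ i∈ → x∈p∪q⁺ (inj₂ i∈)) , x , x∈p∪q⁺ (inj₁ (x∈⁅x⁆ x)) , x≢y ∘ x∈⁅y⁆⇒x≡y y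

module _ (π : Permutation′ n) where

  ∈-image⁺ : ∀ {B i} → π ⟨$⟩ˡ i ∈ B → i ∈ image π B
  ∈-image⁺ {B} {i} h = lookup⇒[]= i (image π B) (trans (lookup∘tabulate _ i) ([]=⇒lookup h))

  ∈-image⁻ : ∀ {B i} → i ∈ image π B → π ⟨$⟩ˡ i ∈ B
  ∈-image⁻ {B} {i} h = lookup⇒[]= _ B (trans (sym (lookup∘tabulate _ i)) ([]=⇒lookup h))

  image-flip : ∀ {B} → image π (image (flip π) B) ≡ B
  image-flip {B} =
    trans (tabulate-cong λ i → trans (lookup∘tabulate _ (π ⟨$⟩ˡ i)) (cong (lookup B) (inverseʳ π)))
          (tabulate∘lookup B)

  image-∘ : ∀ (ρ : Permutation′ n) B → image π (image ρ B) ≡ image (ρ ∘ₚ π) B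
  image-∘ ρ B = tabulate-cong λ i → lookup∘tabulate _ (π ⟨$⟩ˡ i)

  image-replace : ∀ {B x y} → image π (replace B x y) ≡ replace (image π B) (π ⟨$⟩ʳ x) (π ⟨$⟩ʳ y)
  image-replace {B} {x} {y} = ⊆-antisym to from
    where
    to : image π (replace B x y) ⊆ replace (image π B) (π ⟨$⟩ʳ x) (π ⟨$⟩ʳ y)
    to {i} i∈ with ∈-replace⁻ (∈-image⁻ {B = replace B x y} i∈)
    ... | inj₁ (πi∈B , πi≢x) =
      ∈-replace⁺ˡ (∈-image⁺ πi∈B) λ i≡πx → πi≢x (trans (cong (π ⟨$⟩ˡ_) i≡πx) (inverseˡ π))
    ... | inj₂ πi≡y = ∈-replace⁺ʳ (trans (sym (inverseʳ π)) (cong (π ⟨$⟩ʳ_) πi≡y))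

    from : replace (image π B) (π ⟨$⟩ʳ x) (π ⟨$⟩ʳ y) ⊆ image π (replace B x y)
    from {i} i∈ with ∈-replace⁻ i∈
    ... | inj₁ (i∈πB , i≢πx) = ∈-image⁺ {B = replace B x y}
      (∈-replace⁺ˡ (∈-image⁻ i∈πB) λ πi≡x → i≢πx (trans (sym (inverseʳ π)) (cong (π ⟨$⟩ʳ_) πi≡x)))
    ... | inj₂ i≡πy = ∈-image⁺ {B = replace B x y} (∈-replace⁺ʳ (trans (cong (π ⟨$⟩ˡ_) i≡πy) (inverseˡ π)))

image-congˡ : ∀ (π ρ : Permutation′ n) B → (∀ i → π ⟨$⟩ˡ i ≡ ρ ⟨$⟩ˡ i) → image π B ≡ image ρ B
image-congˡ π ρ B eq = tabulate-cong (cong (lookup B) ∘ eq)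

transpose-matchˡ : ∀ (i j : Fin n) → PC.transpose i j i ≡ j
transpose-matchˡ i j rewrite dec-true (i ≟ i) refl = refl

transpose-matchʳ : ∀ (i j : Fin n) → PC.transpose i j j ≡ i
transpose-matchʳ i j with j ≟ i
... | yes j≡i = j≡i
... | no _ rewrite dec-true (j ≟ j) refl = refl

transpose-mismatch : ∀ (i j : Fin n) {k} → k ≢ i → k ≢ j → PC.transpose i j k ≡ k
transpose-mismatch i j {k} k≢i k≢j rewrite dec-false (k ≟ i) k≢i | dec-false (k ≟ j) k≢j = refl

module _ (i j : Fin n) where

  transpose-comm : ∀ k → PC.transpose i j k ≡ PC.transpose j i k
  transpose-comm k = by-cases (k ≟ i) (k ≟ j)
    where
    by-cases : Dec (k ≡ i) → Dec (k ≡ j) → PC.transpose i j k ≡ PC.transpose j i k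
    by-cases (yes refl) _          = trans (transpose-matchˡ k j) (sym (transpose-matchʳ j k))
    by-cases (no _)     (yes refl) = trans (transpose-matchʳ i k) (sym (transpose-matchˡ k i))
    by-cases (no k≢i)   (no k≢j)   =
      trans (transpose-mismatch i j k≢i k≢j) (sym (transpose-mismatch j i k≢j k≢i))

  transpose-conj : ∀ (f : Fin n → Fin n) → (∀ {a b} → f a ≡ f b → a ≡ b) →
                   ∀ k → f (PC.transpose i j k) ≡ PC.transpose (f i) (f j) (f k)
  transpose-conj f f-injective k = by-cases (k ≟ i) (k ≟ j)
    where
    by-cases : Dec (k ≡ i) → Dec (k ≡ j) → f (PC.transpose i j k) ≡ PC.transpose (f i) (f j) (f k)
    by-cases (yes refl) _          =
      trans (cong f (transpose-matchˡ k j)) (sym (transpose-matchˡ (f k) (f j)))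
    by-cases (no _)     (yes refl) =
      trans (cong f (transpose-matchʳ i k)) (sym (transpose-matchʳ (f i) (f k)))
    by-cases (no k≢i)   (no k≢j)   =
      trans (cong f (transpose-mismatch i j k≢i k≢j))
            (sym (transpose-mismatch (f i) (f j) (k≢i ∘ f-injective) (k≢j ∘ f-injective)))

  transpose-invariant : ∀ {A : Set} (f : Fin n → A) → f i ≡ f j → ∀ k → f (PC.transpose i j k) ≡ f k
  transpose-invariant f fi≡fj k = by-cases (k ≟ i) (k ≟ j)
    where
    by-cases : Dec (k ≡ i) → Dec (k ≡ j) → f (PC.transpose i j k) ≡ f k
    by-cases (yes refl) _          = trans (cong f (transpose-matchˡ k j)) (sym fi≡fj)
    by-cases (no _)     (yes refl) = trans (cong f (transpose-matchʳ i k)) fi≡fj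
    by-cases (no k≢i)   (no k≢j)   = cong f (transpose-mismatch i j k≢i k≢j)

module _ (x y : Fin n) {B : Subset n} where

  image-transpose-comm : image (transpose x y) B ≡ image (transpose y x) B
  image-transpose-comm = image-congˡ (transpose x y) (transpose y x) B (transpose-comm y x)

  image-transpose-id : (x ∈ B → y ∈ B) → (y ∈ B → x ∈ B) → image (transpose x y) B ≡ B
  image-transpose-id x⇒y y⇒x =
    trans (tabulate-cong (transpose-invariant y x (lookup B) same-membership)) (tabulate∘lookup B)
    where
    same-membership : lookup B y ≡ lookup B x
    same-membership =
      ⇔→≡ (mk⇔ ([]=⇒lookup ∘ y⇒x ∘ lookup⇒[]= y B) ([]=⇒lookup ∘ x⇒y ∘ lookup⇒[]= x B))

  image-transpose-replace : x ∈ B → y ∉ B → image (transpose x y) B ≡ replace B x y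
  image-transpose-replace x∈B y∉B = ⊆-antisym to from
    where
    to : image (transpose x y) B ⊆ replace B x y
    to {i} i∈ = by-cases (i ≟ y) (i ≟ x) (∈-image⁻ (transpose x y) i∈)
      where
      by-cases : Dec (i ≡ y) → Dec (i ≡ x) → PC.transpose y x i ∈ B → i ∈ replace B x y
      by-cases (yes i≡y) _          _ = ∈-replace⁺ʳ i≡y
      by-cases (no _)    (yes refl) h = ⊥-elim (y∉B (subst (_∈ B) (transpose-matchʳ y i) h))
      by-cases (no i≢y)  (no i≢x)   h =
        ∈-replace⁺ˡ (subst (_∈ B) (transpose-mismatch y x i≢y i≢x) h) i≢x

    from : replace B x y ⊆ image (transpose x y) B
    from {i} i∈ = ∈-image⁺ (transpose x y) (by-cases (∈-replace⁻ i∈))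
      where
      by-cases : (i ∈ B × i ≢ x) ⊎ i ≡ y → PC.transpose y x i ∈ B
      by-cases (inj₂ refl)        = subst (_∈ B) (sym (transpose-matchˡ i x)) x∈B
      by-cases (inj₁ (i∈B , i≢x)) =
        subst (_∈ B) (sym (transpose-mismatch y x (λ { refl → y∉B i∈B }) i≢x)) i∈B

module _ (M : Matroid n) where
  open Matroid M

  Exchangeable : Fin n → Fin n → Set
  Exchangeable x y = ∀ B → IsBasis M B → x ∈ B → y ∉ B → IsBasis M (replace B x y)

  basis-preserving⇒automorphism : ∀ (π : Permutation′ n) →
    (∀ {B} → IsBasis M B → IsBasis M (image π B)) →
    (∀ {B} → IsBasis M B → IsBasis M (image (flip π) B)) → IsIso M M π
  basis-preserving⇒automorphism π preserves preserves⁻¹ B =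
    ⇔→≡ (mk⇔ (λ b → subst (IsBasis M) (image-flip (flip π)) (preserves⁻¹ b)) preserves)

  transpose-preserves-bases : ∀ {x y} → Exchangeable x y → Exchangeable y x →
                              ∀ {B} → IsBasis M B → IsBasis M (image (transpose x y) B)
  transpose-preserves-bases {x} {y} x↦y y↦x {B} b with x ∈? B | y ∈? B
  ... | yes x∈B | yes y∈B =
    subst (IsBasis M) (sym (image-transpose-id x y {B} (const y∈B) (const x∈B))) b
  ... | no x∉B  | no y∉B  =
    subst (IsBasis M) (sym (image-transpose-id x y {B} (⊥-elim ∘ x∉B) (⊥-elim ∘ y∉B))) b
  ... | yes x∈B | no y∉B  =
    subst (IsBasis M) (sym (image-transpose-replace x y {B} x∈B y∉B)) (x↦y B b x∈B y∉B)
  ... | no x∉B  | yes y∈B =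
    subst (IsBasis M) (sym (trans (image-transpose-comm x y {B}) (image-transpose-replace y x {B} y∈B x∉B)))
          (y↦x B b y∈B x∉B)

  exchangeable⇒transpose-automorphism : ∀ {x y} → Exchangeable x y → Exchangeable y x →
                                        IsIso M M (transpose x y)
  exchangeable⇒transpose-automorphism {x} {y} x↦y y↦x =
    basis-preserving⇒automorphism (transpose x y)
      (transpose-preserves-bases {x} {y} x↦y y↦x) (transpose-preserves-bases {y} {x} y↦x x↦y)

  loop⇒exchangeable : ∀ {x y} → Loop M x → Exchangeable x y
  loop⇒exchangeable (dependent , _) B b x∈B _ = ⊥-elim (dependent (B , b , x∈p⇒⁅x⁆⊆p x∈B))

  coloop⇒exchangeable : ∀ {x y} → Coloop M y → Exchangeable x y
  coloop⇒exchangeable y-coloop B b _ y∉B = ⊥-elim (y∉B (y-coloop B b))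

  basis-avoiding : ∀ {x} → ¬ MeetsAllBases M ⁅ x ⁆ → ∃[ B ] (IsBasis M B × x ∉ B)
  basis-avoiding {x} ¬meets =
    decidable-stable (anySubset? λ B → (isBasis B ≟ᵇ true) ×-dec ¬? (x ∈? B)) λ none →
      ¬meets λ B b → x , x∈⁅x⁆ x , decidable-stable (x ∈? B) (λ x∉B → none (B , b , x∉B))

  meets-pair⇒exchangeable : ∀ {x y} → MeetsAllBases M (⁅ x ⁆ ∪ ⁅ y ⁆) →
                            ∃[ B ] (IsBasis M B × x ∉ B) → Exchangeable x y
  meets-pair⇒exchangeable {x} {y} meets (B₀ , b₀ , x∉B₀) B b x∈B y∉B
    with exchange B B₀ b b₀ x x∈B x∉B₀
  ... | z , z∈B₀ , z∉B , b′ = subst (λ w → IsBasis M (replace B x w)) z≡y b′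
    where
    z≡y : z ≡ y
    z≡y with meets _ b′
    ... | w , w∈pair , w∈replace with ∈-pair⁻ w∈pair | ∈-replace⁻ {p = B} {x = x} {y = z} w∈replace
    ...   | inj₁ refl | inj₁ (_ , x≢x) = ⊥-elim (x≢x refl)
    ...   | inj₁ refl | inj₂ x≡z       = ⊥-elim (x∉B₀ (subst (_∈ B₀) (sym x≡z) z∈B₀))
    ...   | inj₂ refl | inj₁ (y∈B , _) = ⊥-elim (y∉B y∈B)
    ...   | inj₂ refl | inj₂ y≡z       = sym y≡z

  series⇒exchangeable : ∀ {x y} → Series M x y → Exchangeable x y
  series⇒exchangeable {x} (x≢y , meets , minimal) =
    meets-pair⇒exchangeable meets (basis-avoiding (minimal ⁅ x ⁆ (⁅x⁆⊂⁅x⁆∪⁅y⁆ x≢y)))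

  series-sym : ∀ {x y} → Series M x y → Series M y x
  series-sym {x} {y} (x≢y , minimally-meets) =
    x≢y ∘ sym ,
    subst (λ S → MeetsAllBases M S × (∀ T → T ⊂ S → ¬ MeetsAllBases M T)) (∪-comm ⁅ x ⁆ ⁅ y ⁆) minimally-meets

  basis-between : ∀ {B₁ S} → IsBasis M B₁ → ∀ {B₂} → IsBasis M B₂ → S ⊆ B₂ →
                  ∃[ B ] (IsBasis M B × S ⊆ B × B ⊆ B₁ ∪ S)
  basis-between {B₁} {S} b₁ b₂ S⊆B₂ = descend b₂ S⊆B₂ (<-wellFounded _)
    where
    excess : Subset n → Subset n
    excess B = B ─ (B₁ ∪ S)

    exchange-excess : ∀ {B} → IsBasis M B → S ⊆ B → ∀ {u} → u ∈ excess B →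
                      ∃[ B′ ] (IsBasis M B′ × S ⊆ B′ × excess B′ ⊂ excess B)
    exchange-excess {B} b S⊆B {u} u∈excess
      with exchange B B₁ b b₁ u (p─q⊆p B _ u∈excess) (x∈p─q⇒x∉q u∈excess ∘ x∈p∪q⁺ ∘ inj₁)
    ... | w , w∈B₁ , w∉B , b′ = replace B u w , b′ , S⊆B′ , shrinks , u , u∈excess , u∉excess′
      where
      S⊆B′ : S ⊆ replace B u w
      S⊆B′ i∈S = ∈-replace⁺ˡ (S⊆B i∈S) λ { refl → x∈p─q⇒x∉q u∈excess (x∈p∪q⁺ (inj₂ i∈S)) }

      shrinks : excess (replace B u w) ⊆ excess B
      shrinks i∈ with ∈-replace⁻ {p = B} {x = u} {y = w} (p─q⊆p _ _ i∈)
      ... | inj₁ (i∈B , _) = x∈p∧x∉q⇒x∈p─q i∈B (x∈p─q⇒x∉q i∈)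
      ... | inj₂ refl      = ⊥-elim (x∈p─q⇒x∉q i∈ (x∈p∪q⁺ (inj₁ w∈B₁)))

      u∉excess′ : u ∉ excess (replace B u w)
      u∉excess′ u∈ with ∈-replace⁻ {p = B} {x = u} {y = w} (p─q⊆p _ _ u∈)
      ... | inj₁ (_ , u≢u) = u≢u refl
      ... | inj₂ refl      = w∉B (p─q⊆p B _ u∈excess)

    descend : ∀ {B} → IsBasis M B → S ⊆ B → Acc _<_ ∣ excess B ∣ →
              ∃[ B′ ] (IsBasis M B′ × S ⊆ B′ × B′ ⊆ B₁ ∪ S)
    descend {B} b S⊆B (acc smaller) with nonempty? (excess B)
    ... | yes (_ , u∈excess) with exchange-excess b S⊆B u∈excess
    ...   | _ , b′ , S⊆B′ , shrinks = descend b′ S⊆B′ (smaller (p⊂q⇒∣p∣<∣q∣ shrinks))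
    descend {B} b S⊆B _ | no no-excess =
      B , b , S⊆B , λ {i} i∈B → decidable-stable (i ∈? B₁ ∪ S) λ i∉ → no-excess (i , x∈p∧x∉q⇒x∈p─q i∈B i∉)

  never-together⇒exchangeable : ∀ {x y} → (∀ B → IsBasis M B → x ∈ B → y ∉ B) →
                                ∃[ B ] (IsBasis M B × y ∈ B) → Exchangeable x y
  never-together⇒exchangeable {x} {y} apart (B₀ , b₀ , y∈B₀) B b x∈B y∉B
    with basis-between b b₀ (x∈p⇒⁅x⁆⊆p y∈B₀)
  ... | B′ , b′ , ⁅y⁆⊆B′ , B′⊆B∪⁅y⁆ = subst (IsBasis M) (⊆-antisym B′⊆replace replace⊆B′) b′
    where
    y∈B′ : y ∈ B′
    y∈B′ = ⁅y⁆⊆B′ (x∈⁅x⁆ y)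

    B′⊆replace : B′ ⊆ replace B x y
    B′⊆replace {i} i∈B′ with x∈p∪q⁻ B ⁅ y ⁆ (B′⊆B∪⁅y⁆ i∈B′)
    ... | inj₁ i∈B   = ∈-replace⁺ˡ i∈B λ { refl → apart B′ b′ i∈B′ y∈B′ }
    ... | inj₂ i∈⁅y⁆ = ∈-replace⁺ʳ (x∈⁅y⁆⇒x≡y y i∈⁅y⁆)

    no-gap : ∀ {i} → i ∈ B → i ≢ x → ¬ i ∉ B′
    no-gap {i} i∈B i≢x i∉B′ with exchange B B′ b b′ i i∈B i∉B′
    ... | z , z∈B′ , z∉B , b″ with x∈p∪q⁻ B ⁅ y ⁆ (B′⊆B∪⁅y⁆ z∈B′)
    ...   | inj₁ z∈B   = z∉B z∈B
    ...   | inj₂ z∈⁅y⁆ =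
      apart (replace B i z) b″ (∈-replace⁺ˡ x∈B (i≢x ∘ sym)) (∈-replace⁺ʳ (sym (x∈⁅y⁆⇒x≡y y z∈⁅y⁆)))

    replace⊆B′ : replace B x y ⊆ B′
    replace⊆B′ {i} i∈ with ∈-replace⁻ i∈
    ... | inj₁ (i∈B , i≢x) = decidable-stable (i ∈? B′) (no-gap i∈B i≢x)
    ... | inj₂ refl        = y∈B′

  parallel⇒exchangeable : ∀ {x y} → Parallel M x y → Exchangeable x y
  parallel⇒exchangeable {x} {y} (x≢y , dependent , minimal) =
    never-together⇒exchangeable (λ B b x∈B y∈B → dependent (B , b , pair⊆ x∈B y∈B)) basis∋y
    where
    basis∋y : ∃[ B ] (IsBasis M B × y ∈ B)
    basis∋y with minimal ⁅ y ⁆ (⁅y⁆⊂⁅x⁆∪⁅y⁆ x≢y)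
    ... | B , b , ⁅y⁆⊆B = B , b , ⁅y⁆⊆B (x∈⁅x⁆ y)

  parallel-sym : ∀ {x y} → Parallel M x y → Parallel M y x
  parallel-sym {x} {y} (x≢y , circuit) = x≢y ∘ sym , subst (Circuit M) (∪-comm ⁅ x ⁆ ⁅ y ⁆) circuit

relabel : Permutation′ n → Matroid n → Matroid n
relabel π M = record
  { isBasis  = isBasis ∘ image π
  ; nonempty = let (B , b) = nonempty in image (flip π) B , subst (IsBasis M) (sym (image-flip π {B})) b
  ; exchange = relabelled-exchange
  }
  where
  open Matroid M
  relabelled-exchange : ∀ B₁ B₂ → IsBasis M (image π B₁) → IsBasis M (image π B₂) →
    ∀ x → x ∈ B₁ → x ∉ B₂ → ∃[ y ] (y ∈ B₂ × y ∉ B₁ × IsBasis M (image π (replace B₁ x y)))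
  relabelled-exchange B₁ B₂ b₁ b₂ x x∈B₁ x∉B₂
    with exchange (image π B₁) (image π B₂) b₁ b₂ (π ⟨$⟩ʳ x)
           (∈-image⁺ π (subst (_∈ B₁) (sym (inverseˡ π)) x∈B₁))
           (x∉B₂ ∘ subst (_∈ B₂) (inverseˡ π) ∘ ∈-image⁻ π)
  ... | y , y∈ , y∉ , b =
    π ⟨$⟩ˡ y , ∈-image⁻ π y∈ , y∉ ∘ ∈-image⁺ π ,
    subst (IsBasis M) (sym (trans (image-replace π {B₁}) (cong (replace _ _) (inverseʳ π)))) b

relabel-isIso : ∀ (π : Permutation′ n) (M : Matroid n) → IsIso (relabel π M) M π
relabel-isIso π M _ = refl

relabel-transposition : ∀ (π : Permutation′ n) {M : Matroid n} {x y} → IsIso M M (transpose x y) →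
                        IsIso (relabel π M) (relabel π M) (transpose (π ⟨$⟩ˡ x) (π ⟨$⟩ˡ y))
relabel-transposition π {M} {x} {y} automorphism B =
  trans (cong (Matroid.isBasis M) conjugate) (automorphism (image π B))
  where
  τ′ = transpose (π ⟨$⟩ˡ x) (π ⟨$⟩ˡ y)

  πˡ-injective : ∀ {a b} → π ⟨$⟩ˡ a ≡ π ⟨$⟩ˡ b → a ≡ b
  πˡ-injective eq = trans (sym (inverseʳ π)) (trans (cong (π ⟨$⟩ʳ_) eq) (inverseʳ π))

  conjugate : image π (image τ′ B) ≡ image (transpose x y) (image π B)
  conjugate = begin
    image π (image τ′ B)                 ≡⟨ image-∘ π τ′ B ⟩
    image (τ′ ∘ₚ π) B                    ≡⟨ image-congˡ (τ′ ∘ₚ π) (π ∘ₚ transpose x y) B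
                                              (sym ∘ transpose-conj y x (π ⟨$⟩ˡ_) πˡ-injective) ⟩
    image (π ∘ₚ transpose x y) B         ≡⟨ image-∘ (transpose x y) π B ⟨
    image (transpose x y) (image π B)    ∎
    where open ≡-Reasoning

permutation-sending-01 : ∀ {m} {x y : Fin (2+ m)} → x ≢ y → ∃[ π ] (π ⟨$⟩ʳ 0F ≡ x × π ⟨$⟩ʳ 1F ≡ y)
permutation-sending-01 {x = x} {y} x≢y =
  transpose 1F z ∘ₚ transpose 0F x , sends-0 , PC.transpose-inverse 0F x
  where
  z = PC.transpose x 0F y

  0≢z : 0F ≢ z
  0≢z 0≡z = x≢y (begin
    x                      ≡⟨ transpose-matchˡ 0F x ⟨
    PC.transpose 0F x 0F   ≡⟨ cong (PC.transpose 0F x) 0≡z ⟩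
    PC.transpose 0F x z    ≡⟨ PC.transpose-inverse 0F x ⟩
    y                      ∎)
    where open ≡-Reasoning

  sends-0 : PC.transpose 0F x (PC.transpose 1F z 0F) ≡ x
  sends-0 = trans (cong (PC.transpose 0F x) (transpose-mismatch 1F z (λ ()) 0≢z)) (transpose-matchˡ 0F x)

no-double-inversion : ∀ (i j : Fin n) → (if does (i <? j) then (if does (j <? i) then 1 else 0) else 0) ≡ 0
no-double-inversion i j with i <? j
... | no i≮j  rewrite dec-false (i <? j) i≮j = refl
... | yes i<j rewrite dec-true (i <? j) i<j | dec-false (j <? i) (<-asymᶠ i<j) = refl

sum-map-≡0 : ∀ {A : Set} (g : A → ℕ) {xs : List A} → All (λ a → g a ≡ 0) xs → sum (map g xs) ≡ 0
sum-map-≡0 g []         = refl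
sum-map-≡0 g (g≡0 ∷ ps) = cong₂ _+_ g≡0 (sum-map-≡0 g ps)

sgn-transpose₀₁ : ∀ m → sgn (transpose {2+ m} 0F 1F) ≡ Sign.-
sgn-transpose₀₁ m = cong parity (begin
  inversions τ                                             ≡⟨⟩
  row 0F + (row 1F + sum (map row (List.tabulate from-2)))  ≡⟨ cong₂ _+_ row₀ (cong₂ _+_ row₁ rows₂₊) ⟩
  1                                                        ∎)
  where
  open ≡-Reasoning
  τ : Fin (2+ m) → Fin (2+ m)
  τ = PC.transpose 0F 1F

  from-2 : Fin m → Fin (2+ m)
  from-2 k = suc (suc k)

  inverted : Fin (2+ m) → Fin (2+ m) → ℕ
  inverted i j = if does (i <? j) then (if does (τ j <? τ i) then 1 else 0) else 0

  row : Fin (2+ m) → ℕ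
  row i = sum (map (inverted i) (allFin (2+ m)))

  row₀ : row 0F ≡ 1
  row₀ = cong suc (sum-map-≡0 (inverted 0F) (tabulate⁺ {f = from-2} λ _ → refl))

  row₁ : row 1F ≡ 0
  row₁ = sum-map-≡0 (inverted 1F) (tabulate⁺ {f = from-2} λ _ → refl)

  rows₂₊ : sum (map row (List.tabulate from-2)) ≡ 0
  rows₂₊ = sum-map-≡0 row (tabulate⁺ λ k →
    sum-map-≡0 (inverted (from-2 k)) (tabulate⁺ {f = from-2} λ l → no-double-inversion (from-2 k) (from-2 l)))

q≡-q⇒q≡0 : ∀ {q : ℚ} → q ≡ - q → q ≡ 0ℚ
q≡-q⇒q≡0 {q} q≡-q with <-cmp q 0ℚ
... | tri≈ _ q≡0 _ = q≡0
... | tri< q<0 _ _ = ⊥-elim (<-asymℚ q<0 (subst (0ℚ <ℚ_) (sym q≡-q) (neg-antimono-< q<0)))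
... | tri> _ _ q>0 = ⊥-elim (<-asymℚ q>0 (subst (_<ℚ 0ℚ) (sym q≡-q) (neg-antimono-< q>0)))

odd-automorphism⇒zero : ∀ (M : Matroid n) {ψ} → IsIso M M ψ → sgn ψ ≡ Sign.- → ∀ η → IsZeroIn𝓜 M η
odd-automorphism⇒zero {n} M {ψ} automorphism odd η f (respects-opposite , respects-iso) =
  q≡-q⇒q≡0 (begin
    f n M η               ≡⟨ respects-iso n M M ψ automorphism η ⟩
    f n M (sgn ψ *ₛ η)    ≡⟨ cong (λ s → f n M (s *ₛ η)) odd ⟩
    f n M (opposite η)    ≡⟨ respects-opposite n M η ⟩
    - f n M η             ∎)
  where open ≡-Reasoning

isomorphic-zero : ∀ {M M′ : Matroid n} {π} → IsIso M M′ π → (∀ η → IsZeroIn𝓜 M η) → ∀ η → IsZeroIn𝓜 M′ η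
isomorphic-zero {n} {M} {M′} {π} iso M-zero η f respects@(_ , respects-iso) = begin
  f n M′ η                         ≡⟨ cong (f n M′) sign-cancels ⟨
  f n M′ (push π (sgn π *ₛ η))     ≡⟨ respects-iso n M M′ π iso (sgn π *ₛ η) ⟨
  f n M (sgn π *ₛ η)               ≡⟨ M-zero (sgn π *ₛ η) f respects ⟩
  0ℚ                               ∎
  where
  open ≡-Reasoning
  sign-cancels : sgn π *ₛ (sgn π *ₛ η) ≡ η
  sign-cancels = trans (sym (*-assoc (sgn π) (sgn π) η)) (cong (_*ₛ η) (s*s≡+ (sgn π)))

transposition-automorphism⇒zero : ∀ {M : Matroid n} {x y} → x ≢ y → IsIso M M (transpose x y) →
                                  ∀ η → IsZeroIn𝓜 M η
transposition-automorphism⇒zero {zero}     {x = ()}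
transposition-automorphism⇒zero {suc zero} {x = zero} {zero} x≢y = ⊥-elim (x≢y refl)
transposition-automorphism⇒zero {2+ m} {M} {x} {y} x≢y automorphism with permutation-sending-01 x≢y
... | π , π0≡x , π1≡y =
  isomorphic-zero {π = π} (relabel-isIso π M)
    (odd-automorphism⇒zero (relabel π M) {transpose 0F 1F} swaps-01 (sgn-transpose₀₁ m))
  where
  preimage : ∀ {i j} → π ⟨$⟩ʳ i ≡ j → π ⟨$⟩ˡ j ≡ i
  preimage refl = inverseˡ π

  swaps-01 : IsIso (relabel π M) (relabel π M) (transpose 0F 1F)
  swaps-01 = subst₂ (λ i j → IsIso (relabel π M) (relabel π M) (transpose i j))
                    (preimage π0≡x) (preimage π1≡y) (relabel-transposition π {M} {x} {y} automorphism)

exchangeable-both-ways⇒zero : ∀ (M : Matroid n) {x y} → x ≢ y →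
                              Exchangeable M x y → Exchangeable M y x → ∀ η → IsZeroIn𝓜 M η
exchangeable-both-ways⇒zero M x≢y x↦y y↦x =
  transposition-automorphism⇒zero x≢y (exchangeable⇒transpose-automorphism M x↦y y↦x)

proposition6p3 : ∀ (n : ℕ) (M : Matroid n) (η : Orientation n) →
    (HasParallel M → IsZeroIn𝓜 M η)
    × (HasTwoLoops M → IsZeroIn𝓜 M η)
    × (HasSeries M → IsZeroIn𝓜 M η)
    × (HasTwoColoops M → IsZeroIn𝓜 M η)
proposition6p3 n M η =
    (λ (_ , _ , parallel) → exchangeable-both-ways⇒zero M (proj₁ parallel)
        (parallel⇒exchangeable M parallel) (parallel⇒exchangeable M (parallel-sym M parallel)) η)
  , (λ (_ , _ , x≢y , x-loop , y-loop) → exchangeable-both-ways⇒zero M x≢y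
        (loop⇒exchangeable M x-loop) (loop⇒exchangeable M y-loop) η)
  , (λ (_ , _ , series) → exchangeable-both-ways⇒zero M (proj₁ series)
        (series⇒exchangeable M series) (series⇒exchangeable M (series-sym M series)) η)
  , (λ (_ , _ , x≢y , x-coloop , y-coloop) → exchangeable-both-ways⇒zero M x≢y
        (coloop⇒exchangeable M y-coloop) (coloop⇒exchangeable M x-coloop) η)
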